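{- Let $G$ be a (finite, simple) graph with diameter $2$. Let $v$ and $w$ be distinct vertices of $G$, and let $d:=\min\{\deg(v),\deg(w)\}$. Then there are $d$ pairwise edge-disjoint paths between $v$ and $w$ in $G$, each of length (number of edges) at most $4$. -}

module Defs where

open import Data.Nat using (ℕ; suc; _≤_; _⊓_)
open import Data.Fin using (Fin)
open import Data.Fin.Subset using (Subset; ∣_∣)
open import Data.Vec using (tabulate)
open import Data.Bool using (Bool; true; false; T)
open import Data.List using (List; []; _∷_; length)
open import Data.List.Relation.Unary.Unique.Propositional using (Unique)
open import Data.Product using (Σ; ∃; ∃-syntax; _×_; _,_)
open import Data.Sum using (_⊎_)
open import Relation.Binary.PropositionalEquality using (_≡_)
open import Relation.Nullary using (¬_)

record Graph (n : ℕ) : Set where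
  field
    adj       : Fin n → Fin n → Bool
    symmetric : ∀ u v → adj u v ≡ adj v u
    irreflexive : ∀ v → adj v v ≡ false

open Graph public

Adj : ∀ {n} → Graph n → Fin n → Fin n → Set
Adj G u v = T (adj G u v)

neighbourhood : ∀ {n} → Graph n → Fin n → Subset n
neighbourhood G v = tabulate (λ u → adj G v u)

deg : ∀ {n} → Graph n → Fin n → ℕ
deg G v = ∣ neighbourhood G v ∣

DistLe2 : ∀ {n} → Graph n → Fin n → Fin n → Set
DistLe2 G u v = u ≡ v ⊎ Adj G u v ⊎ (∃[ x ] (Adj G u x × Adj G x v))

HasDiameter2 : ∀ {n} → Graph n → Set
HasDiameter2 G =
  (∀ u v → DistLe2 G u v) ×
  (∃[ u ] ∃[ v ] (¬ u ≡ v × ¬ Adj G u v))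

data Walk {n} (G : Graph n) : Fin n → Fin n → List (Fin n) → Set where
  single : ∀ v → Walk G v v (v ∷ [])
  cons   : ∀ {u x w vs} → Adj G u x → Walk G x w (x ∷ vs) →
           Walk G u w (u ∷ x ∷ vs)

record Path {n} (G : Graph n) (v w : Fin n) : Set where
  constructor mkPath
  field
    vertices : List (Fin n)
    walk     : Walk G v w vertices
    distinct : Unique vertices

open Path public

edgeCount : ∀ {A : Set} → List A → ℕ
edgeCount []       = 0
edgeCount (_ ∷ []) = 0
edgeCount (_ ∷ x ∷ xs) = suc (edgeCount (x ∷ xs))

pathLength : ∀ {n} {G : Graph n} {v w} → Path G v w → ℕ
pathLength p = edgeCount (vertices p)

data UsesEdge {A : Set} (a b : A) : List A → Set where
  here-ab : ∀ {xs} → UsesEdge a b (a ∷ b ∷ xs)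
  here-ba : ∀ {xs} → UsesEdge a b (b ∷ a ∷ xs)
  there   : ∀ {x xs} → UsesEdge a b xs → UsesEdge a b (x ∷ xs)

EdgeDisjoint : ∀ {n} {G : Graph n} {v w} → Path G v w → Path G v w → Set
EdgeDisjoint {n} p q =
  ∀ (a b : Fin n) → UsesEdge a b (vertices p) → ¬ UsesEdge a b (vertices q)

-- Let C be the common neighbours of v and w, A the neighbours of v outside N[w]
-- and B those of w outside N[v], so that deg v = |C| + [v ~ w] + |A| and
-- deg w = |C| + [v ~ w] + |B|. Besides the edge vw and the paths v c w (c ∈ C),
-- take a maximal matching between A and B, giving paths v a b w, and pair off
-- the remaining vertices of A and B arbitrarily; this gives min(|A|, |B|) pairs
-- and hence min(deg v, deg w) paths. By maximality no leftover a is adjacent to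
-- a leftover b, so diameter 2 provides a common neighbour x and a path v a x b w.
-- Two of these paths cannot share an edge at v or at w, since their second (and
-- their penultimate) vertices differ; an inner edge shared by two detours would
-- put the middle vertex of one at an end of the other, i.e. give an edge between
-- a leftover of A and a leftover of B.

module Submission where

open import Defs
open import Data.Bool using (Bool; true; false; T; not; _∧_; if_then_else_)
open import Data.Bool.Properties using (∧-identityʳ; ∧-zeroʳ; ∧-comm; T-∧)
open import Data.Empty using (⊥; ⊥-elim)
open import Data.Fin using (Fin; zero; suc; _≟_; inject≤)
open import Data.Fin.Properties using (inject≤-injective)
open import Data.Fin.Subset using (∣_∣)
open import Data.List using (List; []; _∷_; _++_; map; length; lookup; filter; allFin)
import Data.List as List
open import Data.List.Properties using (length-++; length-map; map-++; ++-assoc)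
open import Data.List.Membership.Propositional using (_∈_; find; lose)
open import Data.List.Membership.Propositional.Properties
  using (∈-lookup; ∈-∃++; ∈-++⁺ˡ; ∈-++⁺ʳ; ∈-++⁻; ∈-map⁺; ∈-filter⁻)
open import Data.List.Relation.Binary.Permutation.Propositional
  using (_↭_; ↭-refl; ↭-sym; ↭-trans; prep; ↭⇒↭ₛ; module PermutationReasoning)
open import Data.List.Relation.Binary.Permutation.Propositional.Properties
  using (shift; ++⁺ˡ; ∈-resp-↭; ↭-length)
import Data.List.Relation.Binary.Permutation.Setoid.Properties as Permutationₛ
open import Data.List.Relation.Unary.All as All using (All; []; _∷_)
import Data.List.Relation.Unary.All.Properties as All
open import Data.List.Relation.Unary.AllPairs as AllPairs using (AllPairs; []; _∷_)
import Data.List.Relation.Unary.AllPairs.Properties as AllPairs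
open import Data.List.Relation.Unary.Any using (any?; here; there)
open import Data.List.Relation.Unary.Unique.Propositional using (Unique)
open import Data.List.Relation.Unary.Unique.Propositional.Properties using (filter⁺; allFin⁺)
open import Data.Nat using (zero; suc; _+_; _≤_; _⊓_; z≤n; s≤s)
open import Data.Nat.Properties using (+-suc; +-identityʳ; +-distribˡ-⊓; ⊓-zeroʳ; ≤-reflexive)
open import Data.Product using (Σ; _×_; _,_; proj₁; proj₂; swap; uncurry)
open import Data.Sum using (_⊎_; inj₁; inj₂)
open import Data.Unit using (⊤; tt)
open import Data.Vec using (tabulate)
open import Data.Vec.Properties using (tabulate-cong)
open import Function using (_∘_)
open import Function.Bundles using (module Equivalence)
open import Level using (0ℓ)
open import Relation.Binary using (Rel; Decidable; Symmetric)
open import Relation.Binary.PropositionalEquality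
open import Relation.Nullary using (¬_; Dec; does; yes; no)
open import Relation.Nullary.Decidable using (T?)

unique-++⁻ˡ : ∀ {A : Set} (xs : List A) {ys} → Unique (xs ++ ys) → Unique xs
unique-++⁻ˡ []       _           = []
unique-++⁻ˡ (x ∷ xs) (x∉ ∷ xs!) = All.++⁻ˡ xs x∉ ∷ unique-++⁻ˡ xs xs!

AllPairs-tabulate : ∀ {A : Set} {R : Rel A 0ℓ} {xs} →
                    (∀ {x y} → x ∈ xs → y ∈ xs → R x y) → AllPairs R xs
AllPairs-tabulate {xs = []}     _ = []
AllPairs-tabulate {xs = x ∷ xs} r =
  All.tabulate (r (here refl) ∘ there) ∷ AllPairs-tabulate (λ x∈ y∈ → r (there x∈) (there y∈))

AllPairs-lookup : ∀ {A : Set} {R : Rel A 0ℓ} → Symmetric R → ∀ {xs} → AllPairs R xs →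
                  ∀ {i j} → i ≢ j → R (lookup xs i) (lookup xs j)
AllPairs-lookup _     (r ∷ rs) {zero}  {zero}  i≢j = ⊥-elim (i≢j refl)
AllPairs-lookup _     (r ∷ rs) {zero}  {suc j} _   = All.lookup r (∈-lookup j)
AllPairs-lookup R-sym (r ∷ rs) {suc i} {zero}  _   = R-sym (All.lookup r (∈-lookup i))
AllPairs-lookup R-sym (r ∷ rs) {suc i} {suc j} i≢j = AllPairs-lookup R-sym rs (i≢j ∘ cong suc)

-- Maximal matchings and pairings

module _ {A : Set} where

  record Matching (E : Rel A 0ℓ) (xs ys : List A) : Set where
    field
      matched     : List (A × A)
      restˡ restʳ : List A
      edges       : All (uncurry E) matched
      permˡ       : map proj₁ matched ++ restˡ ↭ xs
      permʳ       : map proj₂ matched ++ restʳ ↭ ys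
      maximal     : ∀ {x y} → x ∈ restˡ → y ∈ restʳ → ¬ E x y

  greedy-matching : ∀ {E : Rel A 0ℓ} → Decidable E → ∀ xs ys → Matching E xs ys
  greedy-matching E? [] ys = record
    { matched = [] ; restˡ = [] ; restʳ = ys ; edges = []
    ; permˡ = ↭-refl ; permʳ = ↭-refl ; maximal = λ () }
  greedy-matching E? (x ∷ xs) ys with any? (E? x) ys
  ... | yes x~ys with find x~ys
  ...   | y , y∈ys , x~y with ∈-∃++ y∈ys
  ...     | ys₁ , ys₂ , refl = record
    { matched = (x , y) ∷ matched ; restˡ = restˡ ; restʳ = restʳ
    ; edges   = x~y ∷ edges
    ; permˡ   = prep x permˡ
    ; permʳ   = ↭-trans (prep y permʳ) (↭-sym (shift y ys₁ ys₂))
    ; maximal = maximal }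
    where open Matching (greedy-matching E? xs (ys₁ ++ ys₂))
  greedy-matching E? (x ∷ xs) ys | no x≁ys = record
    { matched = matched ; restˡ = x ∷ restˡ ; restʳ = restʳ
    ; edges   = edges
    ; permˡ   = ↭-trans (shift x (map proj₁ matched) restˡ) (prep x permˡ)
    ; permʳ   = permʳ
    ; maximal = λ { (here refl) y∈ → x≁ys ∘ lose (∈-resp-↭ permʳ (∈-++⁺ʳ (map proj₂ matched) y∈))
                  ; (there x∈)     → maximal x∈ } }
    where open Matching (greedy-matching E? xs ys)

  private
    refine-↭ : (f : A × A → A) {M₁ M₂ : List (A × A)} {l₁ l₂ xs : List A} →
               map f M₁ ++ l₁ ↭ xs → map f M₂ ++ l₂ ↭ l₁ → map f (M₁ ++ M₂) ++ l₂ ↭ xs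
    refine-↭ f {M₁} {M₂} {l₁} {l₂} {xs} p q = begin
      map f (M₁ ++ M₂) ++ l₂        ≡⟨ cong (_++ l₂) (map-++ f M₁ M₂) ⟩
      (map f M₁ ++ map f M₂) ++ l₂  ≡⟨ ++-assoc (map f M₁) (map f M₂) l₂ ⟩
      map f M₁ ++ (map f M₂ ++ l₂)  ↭⟨ ++⁺ˡ (map f M₁) q ⟩
      map f M₁ ++ l₁                ↭⟨ p ⟩
      xs                            ∎
      where open PermutationReasoning

    length-↭ : (f : A × A → A) (M : List (A × A)) {l xs : List A} →
               map f M ++ l ↭ xs → length xs ≡ length M + length l
    length-↭ f M {l} p =
      trans (sym (↭-length p)) (trans (length-++ (map f M)) (cong (_+ length l) (length-map f M)))

  record Pairing (E : Rel A 0ℓ) (xs ys : List A) : Set where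
    field
      pairs        : List (A × A)
      uniqueˡ      : Unique (map proj₁ pairs)
      uniqueʳ      : Unique (map proj₂ pairs)
      fromˡ        : ∀ {a b} → (a , b) ∈ pairs → a ∈ xs
      fromʳ        : ∀ {a b} → (a , b) ∈ pairs → b ∈ ys
      length-pairs : length pairs ≡ length xs ⊓ length ys
      unlinked     : ∀ {a b a′ b′} → (a , b) ∈ pairs → (a′ , b′) ∈ pairs →
                     ¬ E a b → ¬ E a′ b′ → ¬ E a b′

  -- A maximal matching, followed by a greedy matching of the leftovers for the
  -- complete relation, which pairs them off until one side runs out.
  pairing : ∀ {E : Rel A 0ℓ} → Decidable E → ∀ {xs ys} → Unique xs → Unique ys → Pairing E xs ys
  pairing {E} E? {xs} {ys} xs! ys! = record
    { pairs        = M₁ ++ M₂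
    ; uniqueˡ      = unique-++⁻ˡ (map proj₁ (M₁ ++ M₂)) (Unique-resp-↭ (↭⇒↭ₛ (↭-sym permˡ)) xs!)
    ; uniqueʳ      = unique-++⁻ˡ (map proj₂ (M₁ ++ M₂)) (Unique-resp-↭ (↭⇒↭ₛ (↭-sym permʳ)) ys!)
    ; fromˡ        = λ ab∈ → ∈-resp-↭ permˡ (∈-++⁺ˡ (∈-map⁺ proj₁ ab∈))
    ; fromʳ        = λ ab∈ → ∈-resp-↭ permʳ (∈-++⁺ˡ (∈-map⁺ proj₂ ab∈))
    ; length-pairs = length-pairs
    ; unlinked     = unlinked
    }
    where
    open Permutationₛ (setoid A) using (Unique-resp-↭)

    m₁ : Matching E xs ys
    m₁ = greedy-matching E? xs ys
    open Matching m₁ using (edges; maximal)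
      renaming (matched to M₁; restˡ to l₁; restʳ to r₁; permˡ to permˡ₁; permʳ to permʳ₁)

    m₂ : Matching (λ _ _ → ⊤) l₁ r₁
    m₂ = greedy-matching (λ _ _ → yes tt) l₁ r₁
    open Matching m₂ using ()
      renaming (matched to M₂; restˡ to l₂; restʳ to r₂; permˡ to permˡ₂; permʳ to permʳ₂;
                maximal to maximal₂)

    permˡ : map proj₁ (M₁ ++ M₂) ++ l₂ ↭ xs
    permˡ = refine-↭ proj₁ permˡ₁ permˡ₂

    permʳ : map proj₂ (M₁ ++ M₂) ++ r₂ ↭ ys
    permʳ = refine-↭ proj₂ permʳ₁ permʳ₂

    exhausted : length l₂ ⊓ length r₂ ≡ 0
    exhausted with l₂ | r₂ | maximal₂
    ... | []    | _     | _         = refl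
    ... | x ∷ l | []    | _         = ⊓-zeroʳ (length (x ∷ l))
    ... | _ ∷ _ | _ ∷ _ | maximal₂′ = ⊥-elim (maximal₂′ (here refl) (here refl) tt)

    length-pairs : length (M₁ ++ M₂) ≡ length xs ⊓ length ys
    length-pairs = sym (begin
      length xs ⊓ length ys              ≡⟨ cong₂ _⊓_ (length-↭ proj₁ (M₁ ++ M₂) permˡ)
                                                     (length-↭ proj₂ (M₁ ++ M₂) permʳ) ⟩
      (k + length l₂) ⊓ (k + length r₂)  ≡⟨ +-distribˡ-⊓ k (length l₂) (length r₂) ⟨
      k + (length l₂ ⊓ length r₂)        ≡⟨ cong (k +_) exhausted ⟩
      k + 0                              ≡⟨ +-identityʳ k ⟩
      k                                  ∎)
      where
      k = length (M₁ ++ M₂)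
      open ≡-Reasoning

    unlinked : ∀ {a b a′ b′} → (a , b) ∈ M₁ ++ M₂ → (a′ , b′) ∈ M₁ ++ M₂ →
               ¬ E a b → ¬ E a′ b′ → ¬ E a b′
    unlinked ab∈ a′b′∈ a≁b a′≁b′ with ∈-++⁻ M₁ ab∈ | ∈-++⁻ M₁ a′b′∈
    ... | inj₁ ab∈M₁ | _            = ⊥-elim (a≁b (All.lookup edges ab∈M₁))
    ... | inj₂ _     | inj₁ a′b′∈M₁ = ⊥-elim (a′≁b′ (All.lookup edges a′b′∈M₁))
    ... | inj₂ ab∈M₂ | inj₂ a′b′∈M₂ =
      maximal (∈-resp-↭ permˡ₂ (∈-++⁺ˡ (∈-map⁺ proj₁ ab∈M₂)))
              (∈-resp-↭ permʳ₂ (∈-++⁺ˡ (∈-map⁺ proj₂ a′b′∈M₂)))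

-- Counting vertices

members : ∀ {n} → (Fin n → Bool) → List (Fin n)
members p = filter (T? ∘ p) (allFin _)

∈-members : ∀ {n} {p : Fin n → Bool} {u} → u ∈ members p → T (p u)
∈-members {n} {p} = proj₂ ∘ ∈-filter⁻ (T? ∘ p) {xs = allFin n}

members-unique : ∀ {n} (p : Fin n → Bool) → Unique (members p)
members-unique {n} p = filter⁺ (T? ∘ p) (allFin⁺ n)

length-filter-tabulate : ∀ {A : Set} {n} (p : A → Bool) (f : Fin n → A) →
  length (filter (T? ∘ p) (List.tabulate f)) ≡ ∣ tabulate (p ∘ f) ∣
length-filter-tabulate {n = zero}  p f = refl
length-filter-tabulate {n = suc n} p f with p (f zero)
... | true  = cong suc (length-filter-tabulate p (f ∘ suc))
... | false = length-filter-tabulate p (f ∘ suc)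

length-members : ∀ {n} (p : Fin n → Bool) → length (members p) ≡ ∣ tabulate p ∣
length-members p = length-filter-tabulate p (λ i → i)

∣tabulate∣-split : ∀ {n} (p q : Fin n → Bool) →
  ∣ tabulate p ∣ ≡ ∣ tabulate (λ u → p u ∧ q u) ∣ + ∣ tabulate (λ u → p u ∧ not (q u)) ∣
∣tabulate∣-split {zero}  p q = refl
∣tabulate∣-split {suc n} p q with p zero | q zero | ∣tabulate∣-split (p ∘ suc) (q ∘ suc)
... | true  | true  | eq = cong suc eq
... | true  | false | eq = trans (cong suc eq) (sym (+-suc _ _))
... | false | _     | eq = eq

∣tabulate∣-false : ∀ {n} (p : Fin n → Bool) → (∀ u → p u ≡ false) → ∣ tabulate p ∣ ≡ 0
∣tabulate∣-false {zero}  p never = refl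
∣tabulate∣-false {suc n} p never rewrite never zero = ∣tabulate∣-false (p ∘ suc) (never ∘ suc)

∣tabulate∣-at : ∀ {n} (p : Fin n → Bool) (a : Fin n) →
  ∣ tabulate (λ u → p u ∧ does (u ≟ a)) ∣ ≡ (if p a then 1 else 0)
∣tabulate∣-at {suc n} p zero with p zero
... | true  = cong suc (∣tabulate∣-false _ (λ u → ∧-zeroʳ (p (suc u))))
... | false = ∣tabulate∣-false _ (λ u → ∧-zeroʳ (p (suc u)))
∣tabulate∣-at {suc n} p (suc a) with p zero
... | true  = ∣tabulate∣-at (p ∘ suc) a
... | false = ∣tabulate∣-at (p ∘ suc) a

-- Neighbourhoods

T-not⁻ : ∀ {b} → T (not b) → ¬ T b
T-not⁻ {true} () _

T-not-does⁻ : ∀ {P : Set} (P? : Dec P) → T (not (does P?)) → ¬ P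
T-not-does⁻ (no ¬p) _ = ¬p

module _ {n} (G : Graph n) where

  private
    V = Fin n

  Adj-sym : ∀ {x y} → Adj G x y → Adj G y x
  Adj-sym {x} {y} = subst T (symmetric G x y)

  Adj-irrefl : ∀ {x y} → Adj G x y → x ≢ y
  Adj-irrefl {x} x~x refl = subst T (irreflexive G x) x~x

  Adj? : Decidable (Adj G)
  Adj? x y = T? (adj G x y)

  common : V → V → List V
  common x y = members (λ u → adj G x u ∧ adj G y u)

  exclusive : V → V → List V
  exclusive x y = members (λ u → (adj G x u ∧ not (adj G y u)) ∧ not (does (u ≟ y)))

  Exclusive : V → V → V → Set
  Exclusive x y a = Adj G x a × ¬ Adj G y a × a ≢ y

  ∈-common : ∀ {x y c} → c ∈ common x y → Adj G x c × Adj G y c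
  ∈-common = Equivalence.to T-∧ ∘ ∈-members

  ∈-exclusive : ∀ {x y a} → a ∈ exclusive x y → Exclusive x y a
  ∈-exclusive a∈ with Equivalence.to T-∧ (∈-members a∈)
  ... | only , a≢y with Equivalence.to T-∧ only
  ...   | x~a , y≁a = x~a , T-not⁻ y≁a , T-not-does⁻ (_ ≟ _) a≢y

  Exclusive-≢ : ∀ {x y a} → Exclusive x y a → a ≢ x × a ≢ y
  Exclusive-≢ (x~a , _ , a≢y) = ≢-sym (Adj-irrefl x~a) , a≢y

  Exclusive-disjoint : ∀ {x y a b} → Exclusive x y a → Exclusive y x b → a ≢ b
  Exclusive-disjoint (_ , y≁a , _) (y~b , _) refl = y≁a y~b

  deg-decomposition : ∀ x y →
    deg G x ≡ length (common x y) + ((if adj G x y then 1 else 0) + length (exclusive x y))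
  deg-decomposition x y = begin
    ∣ tabulate (adj G x) ∣
      ≡⟨ ∣tabulate∣-split (adj G x) (adj G y) ⟩
    ∣ tabulate both ∣ + ∣ tabulate only ∣
      ≡⟨ cong (∣ tabulate both ∣ +_) (∣tabulate∣-split only (λ u → does (u ≟ y))) ⟩
    ∣ tabulate both ∣ + (∣ tabulate (λ u → only u ∧ does (u ≟ y)) ∣ + ∣ tabulate only-not-y ∣)
      ≡⟨ cong (λ k → ∣ tabulate both ∣ + (k + ∣ tabulate only-not-y ∣)) (∣tabulate∣-at only y) ⟩
    ∣ tabulate both ∣ + ((if only y then 1 else 0) + ∣ tabulate only-not-y ∣)
      ≡⟨ cong (λ b → ∣ tabulate both ∣ + ((if b then 1 else 0) + ∣ tabulate only-not-y ∣)) only-y ⟩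
    ∣ tabulate both ∣ + ((if adj G x y then 1 else 0) + ∣ tabulate only-not-y ∣)
      ≡⟨ cong₂ (λ k l → k + ((if adj G x y then 1 else 0) + l))
               (length-members both) (length-members only-not-y) ⟨
    length (common x y) + ((if adj G x y then 1 else 0) + length (exclusive x y))
      ∎
    where
    open ≡-Reasoning
    both only only-not-y : V → Bool
    both u       = adj G x u ∧ adj G y u
    only u       = adj G x u ∧ not (adj G y u)
    only-not-y u = only u ∧ not (does (u ≟ y))
    only-y : only y ≡ adj G x y
    only-y rewrite irreflexive G y = ∧-identityʳ (adj G x y)

  length-common-comm : ∀ x y → length (common x y) ≡ length (common y x)
  length-common-comm x y = begin
    length (common x y)                        ≡⟨ length-members (λ u → adj G x u ∧ adj G y u) ⟩
    ∣ tabulate (λ u → adj G x u ∧ adj G y u) ∣ ≡⟨ cong ∣_∣ (tabulate-cong (λ u → ∧-comm (adj G x u) (adj G y u))) ⟩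
    ∣ tabulate (λ u → adj G y u ∧ adj G x u) ∣ ≡⟨ length-members (λ u → adj G y u ∧ adj G x u) ⟨
    length (common y x)                        ∎
    where open ≡-Reasoning

-- Routes from v to w

module Routes {n} (G : Graph n) (dist≤2 : ∀ x y → DistLe2 G x y) (v w : Fin n) (v≢w : v ≢ w) where

  private
    V = Fin n
    _~_ = Adj G

  -- The fallback a is a junk value: middle a b is only used for distinct,
  -- non-adjacent a and b.
  middle : V → V → V
  middle a b with dist≤2 a b
  ... | inj₂ (inj₂ (x , _)) = x
  ... | _                   = a

  middle-adj : ∀ {a b} → a ≢ b → ¬ a ~ b → a ~ middle a b × middle a b ~ b
  middle-adj {a} {b} a≢b a≁b with dist≤2 a b
  ... | inj₁ a≡b                    = ⊥-elim (a≢b a≡b)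
  ... | inj₂ (inj₁ a~b)             = ⊥-elim (a≁b a~b)
  ... | inj₂ (inj₂ (_ , a~x , x~b)) = a~x , x~b

  data Route : Set where
    direct  : Route
    via     : V → Route
    matched : V → V → Route
    detour  : V → V → V → Route

  route-vertices : Route → List V
  route-vertices direct         = v ∷ w ∷ []
  route-vertices (via c)        = v ∷ c ∷ w ∷ []
  route-vertices (matched a b)  = v ∷ a ∷ b ∷ w ∷ []
  route-vertices (detour a x b) = v ∷ a ∷ x ∷ b ∷ w ∷ []

  second : Route → V
  second direct         = w
  second (via c)        = c
  second (matched a _)  = a
  second (detour a _ _) = a

  penultimate : Route → V
  penultimate direct         = v
  penultimate (via c)        = c
  penultimate (matched _ b)  = b
  penultimate (detour _ _ b) = b

  Valid : Route → Set
  Valid direct         = v ~ w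
  Valid (via c)        = v ~ c × w ~ c
  Valid (matched a b)  = Exclusive G v w a × Exclusive G w v b × a ~ b
  Valid (detour a x b) = Exclusive G v w a × Exclusive G w v b × a ~ x × x ~ b

  Inner : V → Set
  Inner x = x ≢ v × x ≢ w

  middle-inner : ∀ {a x b} → Valid (detour a x b) → Inner x
  middle-inner ((_ , w≁a , _) , (_ , v≁b , _) , a~x , x~b) =
    (λ { refl → v≁b x~b }) , (λ { refl → w≁a (Adj-sym G a~x) })

  route-walk : ∀ S → Valid S → Walk G v w (route-vertices S)
  route-walk direct         v~w         = cons v~w (single w)
  route-walk (via c)        (v~c , w~c) = cons v~c (cons (Adj-sym G w~c) (single w))
  route-walk (matched a b)  ((v~a , _) , (w~b , _) , a~b) =
    cons v~a (cons a~b (cons (Adj-sym G w~b) (single w)))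
  route-walk (detour a x b) ((v~a , _) , (w~b , _) , a~x , x~b) =
    cons v~a (cons a~x (cons x~b (cons (Adj-sym G w~b) (single w))))

  route-unique : ∀ S → Valid S → Unique (route-vertices S)
  route-unique direct _ = (v≢w ∷ []) ∷ [] ∷ []
  route-unique (via c) (v~c , w~c) =
    (Adj-irrefl G v~c ∷ v≢w ∷ []) ∷ (≢-sym (Adj-irrefl G w~c) ∷ []) ∷ [] ∷ []
  route-unique (matched a b) (ea , eb , _) =
    (Adj-irrefl G (proj₁ ea) ∷ ≢-sym (proj₂ (Exclusive-≢ G eb)) ∷ v≢w ∷ []) ∷
    (Exclusive-disjoint G ea eb ∷ proj₂ (Exclusive-≢ G ea) ∷ []) ∷
    (proj₁ (Exclusive-≢ G eb) ∷ []) ∷ [] ∷ []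
  route-unique (detour a x b) s@(ea , eb , a~x , x~b) =
    (Adj-irrefl G (proj₁ ea) ∷ ≢-sym (proj₁ (middle-inner s)) ∷
       ≢-sym (proj₂ (Exclusive-≢ G eb)) ∷ v≢w ∷ []) ∷
    (Adj-irrefl G a~x ∷ Exclusive-disjoint G ea eb ∷ proj₂ (Exclusive-≢ G ea) ∷ []) ∷
    (Adj-irrefl G x~b ∷ proj₂ (middle-inner s) ∷ []) ∷
    (proj₁ (Exclusive-≢ G eb) ∷ []) ∷ [] ∷ []

  route-path : ∀ S → Valid S → Path G v w
  route-path S s = mkPath (route-vertices S) (route-walk S s) (route-unique S s)

  route-length≤4 : ∀ S s → pathLength (route-path S s) ≤ 4
  route-length≤4 direct         _ = s≤s z≤n
  route-length≤4 (via _)        _ = s≤s (s≤s z≤n)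
  route-length≤4 (matched _ _)  _ = s≤s (s≤s (s≤s z≤n))
  route-length≤4 (detour _ _ _) _ = s≤s (s≤s (s≤s (s≤s z≤n)))

  SameEdge : V → V → V → V → Set
  SameEdge p q x y = (p ≡ x × q ≡ y) ⊎ (p ≡ y × q ≡ x)

  same-edge-cases : ∀ {p q x y x′ y′} → SameEdge p q x y → SameEdge p q x′ y′ →
                    (x ≡ x′ × y ≡ y′) ⊎ (x ≡ y′ × y ≡ x′)
  same-edge-cases (inj₁ (refl , refl)) (inj₁ (refl , refl)) = inj₁ (refl , refl)
  same-edge-cases (inj₁ (refl , refl)) (inj₂ (refl , refl)) = inj₂ (refl , refl)
  same-edge-cases (inj₂ (refl , refl)) (inj₁ (refl , refl)) = inj₂ (refl , refl)
  same-edge-cases (inj₂ (refl , refl)) (inj₂ (refl , refl)) = inj₁ (refl , refl)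

  same-edge-cancelˡ : ∀ {p q x y y′} → SameEdge p q x y → SameEdge p q x y′ → y ≡ y′
  same-edge-cancelˡ e e′ with same-edge-cases e e′
  ... | inj₁ (_ , y≡y′)    = y≡y′
  ... | inj₂ (refl , refl) = refl

  same-edge-cancelʳ : ∀ {p q x x′ y} → SameEdge p q x y → SameEdge p q x′ y → x ≡ x′
  same-edge-cancelʳ e e′ with same-edge-cases e e′
  ... | inj₁ (x≡x′ , _)    = x≡x′
  ... | inj₂ (refl , refl) = refl

  same-edge-inner : ∀ {p q x y} → Inner x → Inner y → SameEdge p q x y → Inner p × Inner q
  same-edge-inner ix iy (inj₁ (refl , refl)) = ix , iy
  same-edge-inner ix iy (inj₂ (refl , refl)) = iy , ix

  Core : Route → V → V → Set
  Core (matched a b)  p q = SameEdge p q a b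
  Core (detour a x b) p q = SameEdge p q a x ⊎ SameEdge p q x b
  Core _              _ _ = ⊥

  data EdgeKind (S : Route) (p q : V) : Set where
    first : SameEdge p q v (second S) → EdgeKind S p q
    last  : penultimate S ≢ v → SameEdge p q (penultimate S) w → EdgeKind S p q
    core  : Inner p → Inner q → Core S p q → EdgeKind S p q

  private
    uses-∷ : ∀ {p q x y zs} → UsesEdge p q (x ∷ y ∷ zs) → SameEdge p q x y ⊎ UsesEdge p q (y ∷ zs)
    uses-∷ here-ab   = inj₁ (inj₁ (refl , refl))
    uses-∷ here-ba   = inj₁ (inj₂ (refl , refl))
    uses-∷ (there u) = inj₂ u

    uses-[] : ∀ {p q x : V} → ¬ UsesEdge p q (x ∷ [])
    uses-[] (there ())

    core-edge : ∀ {S p q x y} → Inner x → Inner y → (e : SameEdge p q x y) →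
                (SameEdge p q x y → Core S p q) → EdgeKind S p q
    core-edge ix iy e c = uncurry core (same-edge-inner ix iy e) (c e)

  edge-kind : ∀ S → Valid S → ∀ {p q} → UsesEdge p q (route-vertices S) → EdgeKind S p q
  edge-kind direct _ u with uses-∷ u
  ... | inj₁ e = first e
  ... | inj₂ u = ⊥-elim (uses-[] u)
  edge-kind (via c) (v~c , w~c) u with uses-∷ u
  ... | inj₁ e = first e
  ... | inj₂ u with uses-∷ u
  ...   | inj₁ e = last (≢-sym (Adj-irrefl G v~c)) e
  ...   | inj₂ u = ⊥-elim (uses-[] u)
  edge-kind (matched a b) (ea , eb , _) u with uses-∷ u
  ... | inj₁ e = first e
  ... | inj₂ u with uses-∷ u
  ...   | inj₁ e = core-edge (Exclusive-≢ G ea) (swap (Exclusive-≢ G eb)) e (λ e → e)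
  ...   | inj₂ u with uses-∷ u
  ...     | inj₁ e = last (proj₂ (Exclusive-≢ G eb)) e
  ...     | inj₂ u = ⊥-elim (uses-[] u)
  edge-kind (detour a x b) s@(ea , eb , _) u with uses-∷ u
  ... | inj₁ e = first e
  ... | inj₂ u with uses-∷ u
  ...   | inj₁ e = core-edge (Exclusive-≢ G ea) (middle-inner s) e inj₁
  ...   | inj₂ u with uses-∷ u
  ...     | inj₁ e = core-edge (middle-inner s) (swap (Exclusive-≢ G eb)) e inj₂
  ...     | inj₂ u with uses-∷ u
  ...       | inj₁ e = last (proj₂ (Exclusive-≢ G eb)) e
  ...       | inj₂ u = ⊥-elim (uses-[] u)

  Unlinked : Route → Route → Set
  Unlinked (detour a _ b) (detour a′ _ b′) = ¬ a ~ b′ × ¬ a′ ~ b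
  Unlinked _              _                = ⊤

  Compatible : Route → Route → Set
  Compatible S T = second S ≢ second T × penultimate S ≢ penultimate T × Unlinked S T

  core-disjoint : ∀ S T → Valid S → Valid T → Compatible S T → ∀ {p q} → Core S p q → Core T p q → ⊥
  core-disjoint (matched a b) (matched a′ b′) (ea , _) (_ , eb′ , _) (a≢a′ , _) e e′
    with same-edge-cases e e′
  ... | inj₁ (a≡a′ , _) = a≢a′ a≡a′
  ... | inj₂ (a≡b′ , _) = Exclusive-disjoint G ea eb′ a≡b′
  core-disjoint (matched a b) (detour a′ x′ b′) (ea , eb , _) (ea′ , eb′ , _) (a≢a′ , b≢b′ , _) = cross
    where
    cross : ∀ {p q} → Core (matched a b) p q → Core (detour a′ x′ b′) p q → ⊥
    cross e (inj₁ e′) with same-edge-cases e e′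
    ... | inj₁ (a≡a′ , _) = a≢a′ a≡a′
    ... | inj₂ (_ , b≡a′) = Exclusive-disjoint G ea′ eb (sym b≡a′)
    cross e (inj₂ e′) with same-edge-cases e e′
    ... | inj₁ (_ , b≡b′) = b≢b′ b≡b′
    ... | inj₂ (a≡b′ , _) = Exclusive-disjoint G ea eb′ a≡b′
  core-disjoint (detour a x b) (matched a′ b′) (ea , eb , _) (ea′ , eb′ , _) (a≢a′ , b≢b′ , _) = cross
    where
    cross : ∀ {p q} → Core (detour a x b) p q → Core (matched a′ b′) p q → ⊥
    cross (inj₁ e) e′ with same-edge-cases e e′
    ... | inj₁ (a≡a′ , _) = a≢a′ a≡a′
    ... | inj₂ (a≡b′ , _) = Exclusive-disjoint G ea eb′ a≡b′
    cross (inj₂ e) e′ with same-edge-cases e e′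
    ... | inj₁ (_ , b≡b′) = b≢b′ b≡b′
    ... | inj₂ (_ , b≡a′) = Exclusive-disjoint G ea′ eb (sym b≡a′)
  core-disjoint (detour a x b) (detour a′ x′ b′) (ea , eb , a~x , x~b) (ea′ , eb′ , _)
                (a≢a′ , b≢b′ , a≁b′ , a′≁b) = cross
    where
    cross : ∀ {p q} → Core (detour a x b) p q → Core (detour a′ x′ b′) p q → ⊥
    cross (inj₁ e) (inj₁ e′) with same-edge-cases e e′
    ... | inj₁ (a≡a′ , _) = a≢a′ a≡a′
    ... | inj₂ (_ , refl) = a′≁b x~b
    cross (inj₁ e) (inj₂ e′) with same-edge-cases e e′
    ... | inj₁ (_ , refl) = a≁b′ a~x
    ... | inj₂ (a≡b′ , _) = Exclusive-disjoint G ea eb′ a≡b′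
    cross (inj₂ e) (inj₁ e′) with same-edge-cases e e′
    ... | inj₁ (refl , _) = a′≁b x~b
    ... | inj₂ (_ , b≡a′) = Exclusive-disjoint G ea′ eb (sym b≡a′)
    cross (inj₂ e) (inj₂ e′) with same-edge-cases e e′
    ... | inj₁ (_ , b≡b′) = b≢b′ b≡b′
    ... | inj₂ (refl , _) = a≁b′ a~x

  private
    endpointˡ : ∀ {p q x y} → SameEdge p q x y → p ≡ x ⊎ q ≡ x
    endpointˡ (inj₁ (p≡x , _)) = inj₁ p≡x
    endpointˡ (inj₂ (_ , q≡x)) = inj₂ q≡x

    endpointʳ : ∀ {p q x y} → SameEdge p q x y → p ≡ y ⊎ q ≡ y
    endpointʳ (inj₁ (_ , q≡y)) = inj₂ q≡y
    endpointʳ (inj₂ (p≡y , _)) = inj₁ p≡y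

    inner-endpoint : ∀ {p q z} → Inner p → Inner q → p ≡ z ⊎ q ≡ z → Inner z
    inner-endpoint ip _ (inj₁ refl) = ip
    inner-endpoint _ iq (inj₂ refl) = iq

  edge-kinds-disjoint : ∀ S T → Valid S → Valid T → Compatible S T →
                        ∀ {p q} → EdgeKind S p q → EdgeKind T p q → ⊥
  edge-kinds-disjoint S T s t (s≢t , _) (first e) (first e′) = s≢t (same-edge-cancelˡ e e′)
  edge-kinds-disjoint S T s t _ (first e) (last t≢v e′) with same-edge-cases e e′
  ... | inj₁ (v≡t , _) = t≢v (sym v≡t)
  ... | inj₂ (v≡w , _) = v≢w v≡w
  edge-kinds-disjoint S T s t _ (first e) (core ip iq _) = proj₁ (inner-endpoint ip iq (endpointˡ e)) refl
  edge-kinds-disjoint S T s t _ (last s≢v e) (first e′) with same-edge-cases e e′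
  ... | inj₁ (s≡v , _) = s≢v s≡v
  ... | inj₂ (_ , w≡v) = v≢w (sym w≡v)
  edge-kinds-disjoint S T s t (_ , s≢t , _) (last _ e) (last _ e′) = s≢t (same-edge-cancelʳ e e′)
  edge-kinds-disjoint S T s t _ (last _ e) (core ip iq _) = proj₂ (inner-endpoint ip iq (endpointʳ e)) refl
  edge-kinds-disjoint S T s t _ (core ip iq _) (first e′) = proj₁ (inner-endpoint ip iq (endpointˡ e′)) refl
  edge-kinds-disjoint S T s t _ (core ip iq _) (last _ e′) = proj₂ (inner-endpoint ip iq (endpointʳ e′)) refl
  edge-kinds-disjoint S T s t c (core _ _ k) (core _ _ k′) = core-disjoint S T s t c k k′

  RoutesEdgeDisjoint : Rel Route 0ℓ
  RoutesEdgeDisjoint S T = ∀ s t → EdgeDisjoint (route-path S s) (route-path T t)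

  RoutesEdgeDisjoint-sym : Symmetric RoutesEdgeDisjoint
  RoutesEdgeDisjoint-sym d t s a b u u′ = d s t a b u′ u

  compatible⇒edge-disjoint : ∀ {S T} → Compatible S T → RoutesEdgeDisjoint S T
  compatible⇒edge-disjoint {S} {T} c s t p q u u′ =
    edge-kinds-disjoint S T s t c (edge-kind S s u) (edge-kind T t u′)

  private
    A = exclusive G v w
    B = exclusive G w v
    C = common G v w

    pairing-AB : Pairing _~_ A B
    pairing-AB = pairing (Adj? G) (members-unique _) (members-unique _)

  open Pairing pairing-AB

  bridge : V × V → Route
  bridge (a , b) with Adj? G a b
  ... | yes _ = matched a b
  ... | no  _ = detour a (middle a b) b

  bridge-second : ∀ p → second (bridge p) ≡ proj₁ p
  bridge-second (a , b) with Adj? G a b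
  ... | yes _ = refl
  ... | no  _ = refl

  bridge-penultimate : ∀ p → penultimate (bridge p) ≡ proj₂ p
  bridge-penultimate (a , b) with Adj? G a b
  ... | yes _ = refl
  ... | no  _ = refl

  bridge-valid : ∀ {a b} → Exclusive G v w a → Exclusive G w v b → Valid (bridge (a , b))
  bridge-valid {a} {b} ea eb with Adj? G a b
  ... | yes a~b = ea , eb , a~b
  ... | no  a≁b = ea , eb , middle-adj (Exclusive-disjoint G ea eb) a≁b

  bridge-unlinked : ∀ {p q} → p ∈ pairs → q ∈ pairs → Unlinked (bridge p) (bridge q)
  bridge-unlinked {a , b} {a′ , b′} p∈ q∈ with Adj? G a b | Adj? G a′ b′
  ... | yes _   | _         = tt
  ... | no  _   | yes _     = tt
  ... | no  a≁b | no  a′≁b′ = unlinked p∈ q∈ a≁b a′≁b′ , unlinked q∈ p∈ a′≁b′ a≁b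

  direct-routes : Dec (v ~ w) → List Route
  direct-routes (yes _) = direct ∷ []
  direct-routes (no  _) = []

  routes : List Route
  routes = map via C ++ direct-routes (Adj? G v w) ++ map bridge pairs

  private
    via-valid : ∀ {c} → c ∈ C → Valid (via c)
    via-valid = ∈-common G

    pair-valid : ∀ {p} → p ∈ pairs → Valid (bridge p)
    pair-valid p∈ = bridge-valid (∈-exclusive G (fromˡ p∈)) (∈-exclusive G (fromʳ p∈))

    direct-routes-valid : ∀ d → All Valid (direct-routes d)
    direct-routes-valid (yes v~w) = v~w ∷ []
    direct-routes-valid (no  _)   = []

  routes-valid : All Valid routes
  routes-valid =
    All.++⁺ (All.map⁺ (All.tabulate via-valid))
      (All.++⁺ (direct-routes-valid (Adj? G v w)) (All.map⁺ (All.tabulate pair-valid)))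

  private
    via-direct : ∀ {c} → c ∈ C → Compatible (via c) direct
    via-direct c∈ with ∈-common G c∈
    ... | v~c , w~c = Adj-irrefl G (Adj-sym G w~c) , Adj-irrefl G (Adj-sym G v~c) , tt

    direct-bridge : ∀ {p} → p ∈ pairs → Compatible direct (bridge p)
    direct-bridge {p} p∈ rewrite bridge-second p | bridge-penultimate p =
      ≢-sym (proj₂ (Exclusive-≢ G (∈-exclusive G (fromˡ p∈)))) ,
      ≢-sym (proj₂ (Exclusive-≢ G (∈-exclusive G (fromʳ p∈)))) , tt

    via-bridge : ∀ {c p} → c ∈ C → p ∈ pairs → Compatible (via c) (bridge p)
    via-bridge {c} {p} c∈ p∈ rewrite bridge-second p | bridge-penultimate p with ∈-common G c∈
    ... | v~c , w~c = (λ { refl → proj₁ (proj₂ (∈-exclusive G (fromˡ p∈))) w~c })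
                    , (λ { refl → proj₁ (proj₂ (∈-exclusive G (fromʳ p∈))) v~c }) , tt

    bridges-compatible : AllPairs Compatible (map bridge pairs)
    bridges-compatible = AllPairs.map⁺ (AllPairs.map compatible
      (AllPairs.zip (AllPairs.map⁻ uniqueˡ ,
                     AllPairs.zip (AllPairs.map⁻ uniqueʳ , AllPairs-tabulate bridge-unlinked))))
      where
      compatible : ∀ {p q} → proj₁ p ≢ proj₁ q × proj₂ p ≢ proj₂ q × Unlinked (bridge p) (bridge q) →
                   Compatible (bridge p) (bridge q)
      compatible {p} {q} (a≢a′ , b≢b′ , u) =
        subst₂ _≢_ (sym (bridge-second p)) (sym (bridge-second q)) a≢a′ ,
        subst₂ _≢_ (sym (bridge-penultimate p)) (sym (bridge-penultimate q)) b≢b′ , u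

    direct-routes-compatible : ∀ d → AllPairs Compatible (direct-routes d ++ map bridge pairs)
    direct-routes-compatible (yes _) = All.map⁺ (All.tabulate direct-bridge) ∷ bridges-compatible
    direct-routes-compatible (no  _) = bridges-compatible

    via-compatible : ∀ d {c} → c ∈ C → All (Compatible (via c)) (direct-routes d ++ map bridge pairs)
    via-compatible (yes _) c∈ = via-direct c∈ ∷ All.map⁺ (All.tabulate (via-bridge c∈))
    via-compatible (no  _) c∈ = All.map⁺ (All.tabulate (via-bridge c∈))

  routes-compatible : AllPairs Compatible routes
  routes-compatible =
    AllPairs.++⁺ (AllPairs.map⁺ (AllPairs.map (λ c≢c′ → c≢c′ , c≢c′ , tt) (members-unique _)))
                 (direct-routes-compatible (Adj? G v w))
                 (All.map⁺ (All.tabulate (via-compatible (Adj? G v w))))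

  private
    length-direct-routes : ∀ d → length (direct-routes d) ≡ (if does d then 1 else 0)
    length-direct-routes (yes _) = refl
    length-direct-routes (no  _) = refl

  routes-length : deg G v ⊓ deg G w ≡ length routes
  routes-length = begin
    deg G v ⊓ deg G w
      ≡⟨ cong₂ _⊓_ (deg-decomposition G v w) deg-w ⟩
    (c + (δ + length A)) ⊓ (c + (δ + length B))
      ≡⟨ +-distribˡ-⊓ c _ _ ⟨
    c + ((δ + length A) ⊓ (δ + length B))
      ≡⟨ cong (c +_) (+-distribˡ-⊓ δ _ _) ⟨
    c + (δ + (length A ⊓ length B))
      ≡⟨ cong₂ (λ k l → k + (l + (length A ⊓ length B))) (length-map via C) (length-direct-routes (Adj? G v w)) ⟨
    length (map via C) + (length (direct-routes (Adj? G v w)) + (length A ⊓ length B))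
      ≡⟨ cong (λ k → length (map via C) + (length (direct-routes (Adj? G v w)) + k))
              (trans (length-map bridge pairs) length-pairs) ⟨
    length (map via C) + (length (direct-routes (Adj? G v w)) + length (map bridge pairs))
      ≡⟨ trans (length-++ (map via C)) (cong (length (map via C) +_) (length-++ (direct-routes (Adj? G v w)))) ⟨
    length routes
      ∎
    where
    open ≡-Reasoning
    c = length C
    δ = if adj G v w then 1 else 0
    deg-w : deg G w ≡ c + (δ + length B)
    deg-w = trans (deg-decomposition G w v)
      (cong₂ (λ k b → k + ((if b then 1 else 0) + length B)) (length-common-comm G w v) (symmetric G w v))

theorem2 : ∀ {n} (G : Graph n) → HasDiameter2 G →
    (v w : Fin n) → ¬ v ≡ w →
    Σ (Fin (deg G v ⊓ deg G w) → Path G v w) λ P →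
      (∀ i → pathLength (P i) ≤ 4) ×
      (∀ i j → ¬ i ≡ j → EdgeDisjoint (P i) (P j))
theorem2 G (dist≤2 , _) v w v≢w = path , (λ i → route-length≤4 (route i) (valid i)) , disjoint
  where
  open Routes G dist≤2 v w v≢w

  enough : deg G v ⊓ deg G w ≤ length routes
  enough = ≤-reflexive routes-length

  route : Fin (deg G v ⊓ deg G w) → Route
  route i = lookup routes (inject≤ i enough)

  valid : ∀ i → Valid (route i)
  valid i = All.lookup routes-valid (∈-lookup (inject≤ i enough))

  path : Fin (deg G v ⊓ deg G w) → Path G v w
  path i = route-path (route i) (valid i)

  disjoint : ∀ i j → i ≢ j → EdgeDisjoint (path i) (path j)
  disjoint i j i≢j =
    AllPairs-lookup RoutesEdgeDisjoint-sym (AllPairs.map compatible⇒edge-disjoint routes-compatible)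
      (i≢j ∘ inject≤-injective enough enough i j) (valid i) (valid j)
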